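{- Let $G$ be a matching covered graph, let $X\subseteq V(G)$ be such that $C=\partial(X)$ is a good cut of $G$ with $|C|=3$, let $e_0\in E(G[X])$, and let $e_1\in C$ be an edge that is not depended on by any edge of $E(G[\overline{X}])$, where $\overline{X}=V(G)\setminus X$. Assume that for every edge $e\in (C\cup E(G[X]))\setminus\{e_0\}$, the graph $G-e_0$ has a matching $M$ that contains $e$ and covers every vertex of $X$, and moreover satisfies $M\cap C=\{e\}$ whenever $e\in C\setminus\{e_1\}$. Then $e_0$ is removable in $G$.
   Context: All graphs are finite, simple and undirected. A connected graph is matching covered if every edge lies in some perfect matching. An edge $e$ of a matching covered graph $G$ is removable if $G-e$ is matching covered. $\partial(X)$ denotes the set of edges with exactly one end in $X$, and $G[X]$ the subgraph induced by $X$. An edge cut $\partial(X)$ is tight if every perfect matching of $G$ contains exactly one of its edges; it is separating if for every edge $e$ of $G$ there is a perfect matching $M_e$ with $e\in M_e$ and $|M_e\cap\partial(X)|=1$; it is good if it is separating but not tight. An edge $e$ depends on an edge $f$ if every perfect matching of $G$ containing $e$ also contains $f$. A matching covers a vertex if the vertex is incident with one of its edges. -}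

module Defs where

open import Data.Nat using (ℕ)
open import Data.Fin using (Fin; _<_; _≟_)
open import Data.Fin.Subset using (Subset; _∈_; _∉_)
open import Data.Bool using (Bool; true; false; _∧_; not)
open import Data.Product using (Σ; ∃; _×_; _,_)
open import Data.Sum using (_⊎_)
open import Relation.Nullary using (¬_)
open import Relation.Nullary.Decidable using (⌊_⌋)
open import Relation.Binary.PropositionalEquality using (_≡_)

-- The edge {u,v} with u < v is
-- present iff  G u v ≡ true ; entries G u v with ¬ (u < v) are ignored.
-- (Loops and parallel edges are thus impossible: the graph is simple.)
Graph : ℕ → Set
Graph n = Fin n → Fin n → Bool

record Edge {n : ℕ} (G : Graph n) : Set where
  constructor edge
  field
    u : Fin n
    v : Fin n
    u<v : u < v
    present : G u v ≡ true
open Edge public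

module _ {n : ℕ} where

  SameEnds : {G H : Graph n} → Edge G → Edge H → Set
  SameEnds e f = (u e ≡ u f) × (v e ≡ v f)

  EdgeSet : Graph n → Set₁
  EdgeSet G = Edge G → Set

  Incident : {G : Graph n} → Fin n → Edge G → Set
  Incident x e = (u e ≡ x) ⊎ (v e ≡ x)

  ShareEnd : {G : Graph n} → Edge G → Edge G → Set
  ShareEnd e f = ∃ λ x → Incident x e × Incident x f

  IsMatching : (G : Graph n) → EdgeSet G → Set
  IsMatching G M = ∀ e f → M e → M f → ShareEnd e f → SameEnds e f

  Covers : {G : Graph n} → EdgeSet G → Fin n → Set
  Covers M x = ∃ λ e → M e × Incident x e

  IsPerfectMatching : (G : Graph n) → EdgeSet G → Set
  IsPerfectMatching G M = IsMatching G M × (∀ x → Covers M x)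

  Adjacent : Graph n → Fin n → Fin n → Set
  Adjacent G x y = Σ (Edge G) λ e →
    ((u e ≡ x) × (v e ≡ y)) ⊎ ((u e ≡ y) × (v e ≡ x))

  data Reach (G : Graph n) : Fin n → Fin n → Set where
    here : ∀ {x} → Reach G x x
    step : ∀ {x y z} → Adjacent G x z → Reach G z y → Reach G x y

  Connected : Graph n → Set
  Connected G = ∀ x y → Reach G x y

  MatchingCovered : Graph n → Set₁
  MatchingCovered G =
    Connected G × (∀ e → Σ (EdgeSet G) λ M → IsPerfectMatching G M × M e)

  deleteEdge : (G : Graph n) → Edge G → Graph n
  deleteEdge G e0 x y = G x y ∧ not (⌊ x ≟ u e0 ⌋ ∧ ⌊ y ≟ v e0 ⌋)

  Removable : (G : Graph n) → Edge G → Set₁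
  Removable G e = MatchingCovered (deleteEdge G e)

  Crossing : {G : Graph n} → Subset n → Edge G → Set
  Crossing X e = ((u e ∈ X) × (v e ∉ X)) ⊎ ((u e ∉ X) × (v e ∈ X))

  InsideX : {G : Graph n} → Subset n → Edge G → Set
  InsideX X e = (u e ∈ X) × (v e ∈ X)

  InsideCompl : {G : Graph n} → Subset n → Edge G → Set
  InsideCompl X e = (u e ∉ X) × (v e ∉ X)

  ExactlyOne : {G : Graph n} → EdgeSet G → EdgeSet G → Set
  ExactlyOne M P = (∃ λ e → M e × P e)
                 × (∀ e f → M e → P e → M f → P f → SameEnds e f)

  Tight : (G : Graph n) → Subset n → Set₁
  Tight G X = ∀ M → IsPerfectMatching G M → ExactlyOne M (Crossing {G = G} X)

  Separating : (G : Graph n) → Subset n → Set₁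
  Separating G X = ∀ e → Σ (EdgeSet G) λ M →
    IsPerfectMatching G M × M e × ExactlyOne M (Crossing {G = G} X)

  GoodCut : (G : Graph n) → Subset n → Set₁
  GoodCut G X = Separating G X × ¬ Tight G X

  CutSize3 : (G : Graph n) → Subset n → Set
  CutSize3 G X = Σ (Edge G) λ c₁ → Σ (Edge G) λ c₂ → Σ (Edge G) λ c₃ →
    Crossing X c₁ × Crossing X c₂ × Crossing X c₃
    × ¬ SameEnds c₁ c₂ × ¬ SameEnds c₁ c₃ × ¬ SameEnds c₂ c₃
    × (∀ (e : Edge G) → Crossing X e → SameEnds e c₁ ⊎ SameEnds e c₂ ⊎ SameEnds e c₃)

  DependsOn : (G : Graph n) → Edge G → Edge G → Set₁
  DependsOn G e f = ∀ M → IsPerfectMatching G M → M e → M f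

{-# OPTIONS --safe #-}
module Submission where

-- |X| is odd, since a perfect matching with a single cut edge exists; hence every
-- matching covering X uses one or all three of the edges of C.  Both patterns occur in perfect
-- matchings of G: the first because C is separating, the second because C is not tight.  Given
-- a matching M of G - e₀ covering X and a perfect matching N of G using the same edges of C, the
-- edges of M meeting X together with the edges of N inside X̄ form a perfect matching of G - e₀.
-- An edge meeting X is covered by gluing the matching the hypothesis provides; an edge f inside
-- X̄ lies in a perfect matching N avoiding e₁ (f does not depend on e₁), whose unique cut edge
-- c ≠ e₁ is matched by the hypothesis with M ∩ C = {c}.  Finally G - e₀ is connected, since
-- alternating between a perfect matching through e₀ = ab and one of G - e₀ leads from b to a.

open import Defs
open import Axiom.UniquenessOfIdentityProofs using (module Decidable⇒UIP)
open import Data.Bool using (true)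
import Data.Bool.Properties as Boolₚ
open import Data.Empty using (⊥; ⊥-elim)
open import Data.Fin as Fin using (Fin; zero; suc; _≟_; _<_)
open import Data.Fin.Patterns using (0F; 1F; 2F)
open import Data.Fin.Permutation using (permutation)
import Data.Fin.Properties as Finₚ
open import Data.Fin.Subset using (Subset; _∈_; _∉_; ⊤)
open import Data.Fin.Subset.Properties using (_∈?_; ∈⊤)
open import Data.Nat using (ℕ; zero; suc; _+_; _*_; _%_)
open import Data.Nat.DivMod using ([m+kn]%n≡m%n)
import Data.Nat.Properties as ℕₚ
open import Algebra.Properties.CommutativeMonoid.Sum ℕₚ.+-0-commutativeMonoid
  using (sum; sum-cong-≗; ∑-distrib-+; ∑-comm; sum-permute)
open import Data.Product using (Σ; ∃; ∃₂; _×_; _,_; proj₁; proj₂)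
open import Data.Sum using (_⊎_; inj₁; inj₂; [_,_]′)
open import Data.Vec using (Vec; []; _∷_; lookup; tabulate)
open import Data.Vec.Properties using (lookup∘tabulate)
open import Function using (_⇔_; mk⇔; _∘_; id; Equivalence)
open import Relation.Binary using (tri<; tri≈; tri>)
open import Relation.Binary.PropositionalEquality
open import Relation.Nullary using (¬_; Dec; yes; no)
open import Relation.Nullary.Decidable using (_×-dec_; _⊎-dec_; ¬?; map′)
open import Relation.Unary using (Decidable)

module _ {n : ℕ} where

  data Ends {G : Graph n} (e : Edge G) (p q : Fin n) : Set where
    fwd : u e ≡ p → v e ≡ q → Ends e p q
    bwd : u e ≡ q → v e ≡ p → Ends e p q

  module _ {G : Graph n} {e : Edge G} where

    Ends-self : Ends e (u e) (v e)
    Ends-self = fwd refl refl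

    Ends-sym : ∀ {p q} → Ends e p q → Ends e q p
    Ends-sym (fwd a b) = bwd a b
    Ends-sym (bwd a b) = fwd a b

    Ends-functional : ∀ {p q q′} → Ends e p q → Ends e p q′ → q ≡ q′
    Ends-functional (fwd a b) (fwd a′ b′) = trans (sym b) b′
    Ends-functional (fwd a b) (bwd a′ b′) = trans (sym b) (trans b′ (trans (sym a) a′))
    Ends-functional (bwd a b) (fwd a′ b′) = trans (sym a) (trans a′ (trans (sym b) b′))
    Ends-functional (bwd a b) (bwd a′ b′) = trans (sym a) a′

    Ends-irrefl : ∀ {p} → ¬ Ends e p p
    Ends-irrefl (fwd a b) = Finₚ.<-irrefl (trans a (sym b)) (u<v e)
    Ends-irrefl (bwd a b) = Finₚ.<-irrefl (trans a (sym b)) (u<v e)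

    Ends⇒Incident : ∀ {p q} → Ends e p q → Incident p e
    Ends⇒Incident (fwd a _) = inj₁ a
    Ends⇒Incident (bwd _ b) = inj₂ b


    Ends⇒Adjacent : ∀ {p q} → Ends e p q → Adjacent G p q
    Ends⇒Adjacent (fwd a b) = e , inj₁ (a , b)
    Ends⇒Adjacent (bwd a b) = e , inj₂ (a , b)

  Incident⇒Ends : {G : Graph n} (e : Edge G) {p : Fin n} → Incident p e → ∃ λ q → Ends e p q
  Incident⇒Ends e (inj₁ a) = v e , fwd a refl
  Incident⇒Ends e (inj₂ b) = u e , bwd refl b

  SameEnds⇒Ends : {G H : Graph n} {e : Edge G} {f : Edge H} → SameEnds e f → Ends e (u f) (v f)
  SameEnds⇒Ends (a , b) = fwd a b

  Ends⇒SameEnds : {G H : Graph n} (e : Edge G) (f : Edge H) {p q : Fin n} →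
    Ends e p q → Ends f p q → SameEnds e f
  Ends⇒SameEnds e f (fwd a b) (fwd a′ b′) = trans a (sym a′) , trans b (sym b′)
  Ends⇒SameEnds e f (bwd a b) (bwd a′ b′) = trans a (sym a′) , trans b (sym b′)
  Ends⇒SameEnds e f (fwd a b) (bwd a′ b′) =
    ⊥-elim (Finₚ.<-asym (subst₂ _<_ a b (u<v e)) (subst₂ _<_ a′ b′ (u<v f)))
  Ends⇒SameEnds e f (bwd a b) (fwd a′ b′) =
    ⊥-elim (Finₚ.<-asym (subst₂ _<_ a b (u<v e)) (subst₂ _<_ a′ b′ (u<v f)))

  Ends-transport : {G H : Graph n} {e : Edge G} {f : Edge H} {p q : Fin n} →
    SameEnds e f → Ends e p q → Ends f p q
  Ends-transport (a , b) (fwd a′ b′) = fwd (trans (sym a) a′) (trans (sym b) b′)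
  Ends-transport (a , b) (bwd a′ b′) = bwd (trans (sym a) a′) (trans (sym b) b′)

  sameEnds? : {G H : Graph n} (e : Edge G) (f : Edge H) → Dec (SameEnds e f)
  sameEnds? e f = (u e ≟ u f) ×-dec (v e ≟ v f)

  SameEnds⇒≡ : {G : Graph n} {e f : Edge G} → SameEnds e f → e ≡ f
  SameEnds⇒≡ {e = edge x y p q} {edge .x .y p′ q′} (refl , refl) =
    cong₂ (edge x y) (Finₚ.<-irrelevant p p′) (Decidable⇒UIP.≡-irrelevant Boolₚ._≟_ q q′)

  Pairs : {H : Graph n} → EdgeSet H → Fin n → Fin n → Set
  Pairs M p q = ∃ λ g → M g × Ends g p q

  Pairs⇒∈ : {H : Graph n} {M : EdgeSet H} {f : Edge H} {p q : Fin n} → Pairs M p q → Ends f p q → M f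
  Pairs⇒∈ {M = M} {f} (g , Mg , g-ends) f-ends =
    subst M (SameEnds⇒≡ (Ends⇒SameEnds g f g-ends f-ends)) Mg

  module _ {H : Graph n} {M : EdgeSet H} where

    Pairs-sym : ∀ {p q} → Pairs M p q → Pairs M q p
    Pairs-sym (g , Mg , gpq) = g , Mg , Ends-sym gpq

    Pairs-functional : IsMatching H M → ∀ {p q q′} → Pairs M p q → Pairs M p q′ → q ≡ q′
    Pairs-functional match (g , Mg , gpq) (g′ , Mg′ , gpq′) =
      let g≈g′ = match g g′ Mg Mg′ (_ , Ends⇒Incident gpq , Ends⇒Incident gpq′)
      in Ends-functional (Ends-transport g≈g′ gpq) gpq′

    matching-by-partners : (R : Fin n → Fin n → Set) → (∀ {p q q′} → R p q → R p q′ → q ≡ q′) →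
      (∀ {e p q} → M e → Ends e p q → R p q) → IsMatching H M
    matching-by-partners R functional partner e f Me Mf (z , ze , zf) =
      let (q , ezq) = Incident⇒Ends e ze
          (q′ , fzq′) = Incident⇒Ends f zf
      in Ends⇒SameEnds e f ezq (subst (Ends f z) (functional (partner Mf fzq′) (partner Me ezq)) fzq′)

indicator : {A : Set} → Dec A → ℕ
indicator (yes _) = 1
indicator (no _) = 0

indicator-cong : {A B : Set} → A ⇔ B → (a? : Dec A) (b? : Dec B) → indicator a? ≡ indicator b?
indicator-cong A⇔B (yes _) (yes _) = refl
indicator-cong A⇔B (yes a) (no ¬b) = ⊥-elim (¬b (Equivalence.to A⇔B a))
indicator-cong A⇔B (no ¬a) (yes b) = ⊥-elim (¬a (Equivalence.from A⇔B b))
indicator-cong A⇔B (no _) (no _) = refl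

indicator-split : {A B : Set} (a? : Dec A) (b? : Dec B) →
  indicator a? ≡ indicator (a? ×-dec b?) + indicator (a? ×-dec ¬? b?)
indicator-split (yes _) (yes _) = refl
indicator-split (yes _) (no _) = refl
indicator-split (no _) _ = refl

count : ∀ {m} {P : Fin m → Set} → Decidable P → ℕ
count P? = sum (λ i → indicator (P? i))

module _ {m : ℕ} {P Q : Fin m → Set} (P? : Decidable P) (Q? : Decidable Q) where

  count-cong : (∀ i → P i ⇔ Q i) → count P? ≡ count Q?
  count-cong P⇔Q = sum-cong-≗ (λ i → indicator-cong (P⇔Q i) (P? i) (Q? i))

  count-split : count P? ≡ count (λ i → P? i ×-dec Q? i) + count (λ i → P? i ×-dec ¬? (Q? i))
  count-split = trans (sum-cong-≗ (λ i → indicator-split (P? i) (Q? i)))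
    (∑-distrib-+ (λ i → indicator (P? i ×-dec Q? i)) (λ i → indicator (P? i ×-dec ¬? (Q? i))))

count-none : ∀ {m} {P : Fin m → Set} (P? : Decidable P) → (∀ i → ¬ P i) → count P? ≡ 0
count-none {zero} P? ¬P = refl
count-none {suc m} P? ¬P with P? zero
... | yes p = ⊥-elim (¬P zero p)
... | no _ = count-none (P? ∘ suc) (¬P ∘ suc)

count-unique : ∀ {m} {P : Fin m → Set} (P? : Decidable P) {i : Fin m} →
  P i → (∀ j → P j → j ≡ i) → count P? ≡ 1
count-unique {suc m} P? {zero} p unique with P? zero
... | yes _ = cong suc (count-none (P? ∘ suc) (λ j pj → Finₚ.0≢1+n (sym (unique (suc j) pj))))
... | no ¬p = ⊥-elim (¬p p)
count-unique {suc m} P? {suc i} p unique with P? zero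
... | yes p₀ = ⊥-elim (Finₚ.0≢1+n (unique zero p₀))
... | no _ = count-unique (P? ∘ suc) p (λ j pj → Finₚ.suc-injective (unique (suc j) pj))

count-at : ∀ {m} {B : Set} (a : Fin m) (b? : Dec B) → count (λ x → (x ≟ a) ×-dec b?) ≡ indicator b?
count-at a (yes b) = count-unique (λ x → (x ≟ a) ×-dec yes b) (refl , b) (λ _ → proj₁)
count-at a (no ¬b) = count-none (λ x → (x ≟ a) ×-dec no ¬b) (λ _ → ¬b ∘ proj₂)

count-∘-involution : ∀ {m} {P : Fin m → Set} (P? : Decidable P) (h : Fin m → Fin m) →
  (∀ x → h (h x) ≡ x) → count (P? ∘ h) ≡ count P?
count-∘-involution P? h involutive =
  sym (sum-permute (λ i → indicator (P? i)) (permutation h h involutive involutive))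

module _ {m : ℕ} {P : Fin m → Set} (P? : Decidable P) (h : Fin m → Fin m)
  (h-closed : ∀ {x} → P x → P (h x)) (h-involutive : ∀ {x} → P x → h (h x) ≡ x)
  (h-fixpointFree : ∀ {x} → P x → h x ≢ x) where

  private
    h′ : Fin m → Fin m
    h′ x with P? x
    ... | yes _ = h x
    ... | no _ = x

    h′-in : ∀ {x} → P x → h′ x ≡ h x
    h′-in {x} p with P? x
    ... | yes _ = refl
    ... | no ¬p = ⊥-elim (¬p p)

    h′-out : ∀ {x} → ¬ P x → h′ x ≡ x
    h′-out {x} ¬p with P? x
    ... | yes p = ⊥-elim (¬p p)
    ... | no _ = refl

    h′-involutive : ∀ x → h′ (h′ x) ≡ x
    h′-involutive x with P? x
    ... | yes p = trans (h′-in (h-closed p)) (h-involutive p)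
    ... | no ¬p = h′-out ¬p

    Ascending : Fin m → Set
    Ascending x = P x × x < h x

    ascending? : Decidable Ascending
    ascending? x = P? x ×-dec (x Finₚ.<? h x)

    descending⇔ascending∘h′ : ∀ x → (P x × ¬ x < h x) ⇔ Ascending (h′ x)
    descending⇔ascending∘h′ x = mk⇔ to from
      where
      to : P x × ¬ x < h x → Ascending (h′ x)
      to (p , ¬x<hx) rewrite h′-in p with Finₚ.<-cmp x (h x)
      ... | tri< x<hx _ _ = ⊥-elim (¬x<hx x<hx)
      ... | tri≈ _ x≡hx _ = ⊥-elim (h-fixpointFree p (sym x≡hx))
      ... | tri> _ _ hx<x = h-closed p , subst (h x <_) (sym (h-involutive p)) hx<x
      from : Ascending (h′ x) → P x × ¬ x < h x
      from (q , lt) with P? x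
      ... | yes p = p , λ x<hx → Finₚ.<-asym x<hx (subst (h x <_) (h-involutive p) lt)
      ... | no ¬p = ⊥-elim (¬p q)

  -- h′ exchanges the points of P that h moves up with those it moves down.
  count-even : ∃ λ c → count P? ≡ c * 2
  count-even = count ascending? , (begin
    count P?
      ≡⟨ count-split P? (λ x → x Finₚ.<? h x) ⟩
    count ascending? + count (λ x → P? x ×-dec ¬? (x Finₚ.<? h x))
      ≡⟨ cong (count ascending? +_) (count-cong _ (ascending? ∘ h′) descending⇔ascending∘h′) ⟩
    count ascending? + count (ascending? ∘ h′)
      ≡⟨ cong (count ascending? +_) (count-∘-involution ascending? h′ h′-involutive) ⟩
    count ascending? + count ascending?
      ≡⟨ cong (count ascending? +_) (sym (ℕₚ.+-identityʳ _)) ⟩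
    2 * count ascending?
      ≡⟨ ℕₚ.*-comm 2 (count ascending?) ⟩
    count ascending? * 2 ∎)
    where open ≡-Reasoning

module _ {n : ℕ} where

  _⊆ᴳ_ : Graph n → Graph n → Set
  H ⊆ᴳ G = ∀ x y → H x y ≡ true → G x y ≡ true

  ⊆ᴳ-refl : {G : Graph n} → G ⊆ᴳ G
  ⊆ᴳ-refl _ _ = id

  embed : {H G : Graph n} → H ⊆ᴳ G → Edge H → Edge G
  embed H⊆G e = edge (u e) (v e) (u<v e) (H⊆G _ _ (present e))

  Ends-embed : {H G : Graph n} (H⊆G : H ⊆ᴳ G) {e : Edge H} {p q : Fin n} →
    Ends e p q → Ends (embed H⊆G e) p q
  Ends-embed _ (fwd a b) = fwd a b
  Ends-embed _ (bwd a b) = bwd a b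

  module _ {X : Subset n} {G : Graph n} where

    inner outer : (e : Edge G) → Crossing X e → Fin n
    inner e (inj₁ _) = u e
    inner e (inj₂ _) = v e
    outer e (inj₁ _) = v e
    outer e (inj₂ _) = u e

    inner∈X : (e : Edge G) (c : Crossing X e) → inner e c ∈ X
    inner∈X e (inj₁ (x∈X , _)) = x∈X
    inner∈X e (inj₂ (_ , x∈X)) = x∈X

    outer∉X : (e : Edge G) (c : Crossing X e) → outer e c ∉ X
    outer∉X e (inj₁ (_ , y∉X)) = y∉X
    outer∉X e (inj₂ (y∉X , _)) = y∉X

    Ends-inner-outer : (e : Edge G) (c : Crossing X e) → Ends e (inner e c) (outer e c)
    Ends-inner-outer e (inj₁ _) = fwd refl refl
    Ends-inner-outer e (inj₂ _) = bwd refl refl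

    Ends⇒Crossing : {e : Edge G} {x y : Fin n} → Ends e x y → x ∈ X → y ∉ X → Crossing X e
    Ends⇒Crossing (fwd refl refl) x∈X y∉X = inj₁ (x∈X , y∉X)
    Ends⇒Crossing (bwd refl refl) x∈X y∉X = inj₂ (y∉X , x∈X)

    crossing-orientation : {e : Edge G} {x y x′ y′ : Fin n} → Ends e x y → x ∈ X → y ∉ X →
      Ends e x′ y′ → x′ ∈ X → y′ ∉ X → x ≡ x′ × y ≡ y′
    crossing-orientation (fwd refl refl) _ _ (fwd refl refl) _ _ = refl , refl
    crossing-orientation (bwd refl refl) _ _ (bwd refl refl) _ _ = refl , refl
    crossing-orientation (fwd refl refl) x∈X _ (bwd refl refl) _ y′∉X = ⊥-elim (y′∉X x∈X)
    crossing-orientation (bwd refl refl) x∈X _ (fwd refl refl) _ y′∉X = ⊥-elim (y′∉X x∈X)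

record CutEnumeration {n : ℕ} (G : Graph n) (X : Subset n) (m : ℕ) : Set where
  field
    cutEdge : Fin m → Edge G
    inside outside : Fin m → Fin n
    inside∈X : ∀ j → inside j ∈ X
    outside∉X : ∀ j → outside j ∉ X
    cutEdge-ends : ∀ j → Ends (cutEdge j) (inside j) (outside j)
    injective : ∀ {i j} → inside i ≡ inside j → outside i ≡ outside j → i ≡ j
    complete : ∀ {x y} (e : Edge G) → Ends e x y → x ∈ X → y ∉ X →
      ∃ λ j → inside j ≡ x × outside j ≡ y

module CutEnumerationProperties {n m : ℕ} {G : Graph n} {X : Subset n} (cut : CutEnumeration G X m) where

  open CutEnumeration cut public

  CutPattern : {H : Graph n} → EdgeSet H → Fin m → Set
  CutPattern M j = Pairs M (inside j) (outside j)

  crossing⇒cutEdge : {H : Graph n} → H ⊆ᴳ G → (e : Edge H) → Crossing X e →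
    ∃ λ j → Ends e (inside j) (outside j)
  crossing⇒cutEdge H⊆G e e-crossing =
    let (j , inside≡ , outside≡) =
          complete (embed H⊆G e) (Ends-embed H⊆G (Ends-inner-outer e e-crossing))
                   (inner∈X e e-crossing) (outer∉X e e-crossing)
    in j , subst₂ (Ends e) (sym inside≡) (sym outside≡) (Ends-inner-outer e e-crossing)

  transfer-crossing : {H K : Graph n} → H ⊆ᴳ G → {M : EdgeSet H} {N : EdgeSet K} →
    (∀ j → CutPattern M j → CutPattern N j) → ∀ {x y} → x ∈ X → y ∉ X → Pairs M x y → Pairs N x y
  transfer-crossing H⊆G M⇒N x∈X y∉X (g , Mg , g-ends) =
    let (j , inside≡ , outside≡) = complete (embed H⊆G g) (Ends-embed H⊆G g-ends) x∈X y∉X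
        Mⱼ = g , Mg , subst₂ (Ends g) (sym inside≡) (sym outside≡) g-ends
    in subst₂ (Pairs _) inside≡ outside≡ (M⇒N j Mⱼ)

  only-cutEdge : {H : Graph n} → H ⊆ᴳ G → {M : EdgeSet H} (i : Fin m) →
    (∀ f → M f → Crossing X f → SameEnds f (cutEdge i)) → ∀ j → CutPattern M j → j ≡ i
  only-cutEdge H⊆G i sole j (g , Mg , g-ends) =
    let g-crossing = Ends⇒Crossing g-ends (inside∈X j) (outside∉X j)
        (in≡ , out≡) =
          crossing-orientation (Ends-transport {f = cutEdge i} (sole g Mg g-crossing) g-ends)
            (inside∈X j) (outside∉X j) (cutEdge-ends i) (inside∈X i) (outside∉X i)
    in injective in≡ out≡

  cutEdge-crossing : ∀ j → Crossing X (cutEdge j)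
  cutEdge-crossing j = Ends⇒Crossing (cutEdge-ends j) (inside∈X j) (outside∉X j)

  exactly-agree : {H K : Graph n} {M : EdgeSet H} {N : EdgeSet K} {i : Fin m} →
    CutPattern M i → (∀ j → CutPattern M j → j ≡ i) → CutPattern N i → (∀ j → CutPattern N j → j ≡ i) →
    ∀ j → CutPattern M j ⇔ CutPattern N j
  exactly-agree {M = M} {N} Mᵢ M-only Nᵢ N-only j =
    mk⇔ (λ Mⱼ → subst (CutPattern N) (sym (M-only j Mⱼ)) Nᵢ)
        (λ Nⱼ → subst (CutPattern M) (sym (N-only j Nⱼ)) Mᵢ)

module Partner {n : ℕ} {H : Graph n} {M : EdgeSet H} (M-matching : IsMatching H M)
  {X : Subset n} (M-covers : ∀ x → x ∈ X → Covers M x) where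

  -- Outside X the partner is a junk value (the vertex itself).
  partner : Fin n → Fin n
  partner x with x ∈? X
  ... | yes x∈X = let (g , _ , x∼g) = M-covers x x∈X in proj₁ (Incident⇒Ends g x∼g)
  ... | no _ = x

  partner-pairs : ∀ {x} → x ∈ X → Pairs M x (partner x)
  partner-pairs {x} x∈X with x ∈? X
  ... | yes x∈X′ = let (g , Mg , x∼g) = M-covers x x∈X′ in g , Mg , proj₂ (Incident⇒Ends g x∼g)
  ... | no x∉X = ⊥-elim (x∉X x∈X)

  Pairs⇒partner : ∀ {x q} → x ∈ X → Pairs M x q → partner x ≡ q
  Pairs⇒partner x∈X = Pairs-functional M-matching (partner-pairs x∈X)

  partner-irrefl : ∀ {x} → x ∈ X → partner x ≢ x
  partner-irrefl x∈X eq =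
    let (g , _ , g-ends) = partner-pairs x∈X in Ends-irrefl (subst (Ends g _) eq g-ends)

  partner-involutive : ∀ {x} → x ∈ X → partner x ∈ X → partner (partner x) ≡ x
  partner-involutive x∈X px∈X = Pairs⇒partner px∈X (Pairs-sym (partner-pairs x∈X))

  pairs? : ∀ {x} → x ∈ X → ∀ q → Dec (Pairs M x q)
  pairs? {x} x∈X q =
    map′ (λ eq → subst (Pairs M _) eq (partner-pairs x∈X)) (Pairs⇒partner x∈X) (partner x ≟ q)

module PerfectPartner {n : ℕ} {G : Graph n} {N : EdgeSet G} (N-perfect : IsPerfectMatching G N) =
  Partner (proj₁ N-perfect) {X = ⊤} (λ x _ → proj₂ N-perfect x)

module CutParity {n m : ℕ} {G H : Graph n} {X : Subset n} (cut : CutEnumeration G X m) (H⊆G : H ⊆ᴳ G)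
  {M : EdgeSet H} (M-matching : IsMatching H M) (M-covers : ∀ x → x ∈ X → Covers M x) where

  open CutEnumerationProperties cut
  open Partner M-matching M-covers

  cutPaired? : Decidable (CutPattern M)
  cutPaired? j = pairs? (inside∈X j) (outside j)

  private
    internal? : Decidable (λ x → x ∈ X × partner x ∈ X)
    internal? x = (x ∈? X) ×-dec (partner x ∈? X)

    leaving? : Decidable (λ x → x ∈ X × partner x ∉ X)
    leaving? x = (x ∈? X) ×-dec ¬? (partner x ∈? X)

    exits? : (x : Fin n) → Decidable (λ j → x ≡ inside j × CutPattern M j)
    exits? x j = (x ≟ inside j) ×-dec cutPaired? j

    leaving-count : ∀ x → indicator (leaving? x) ≡ count (exits? x)
    leaving-count x with leaving? x
    ... | no ¬leaving = sym (count-none (exits? x) λ { j (refl , j-paired) →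
      ¬leaving (inside∈X j , λ p∈X →
        outside∉X j (subst (_∈ X) (Pairs⇒partner (inside∈X j) j-paired) p∈X)) })
    ... | yes (x∈X , px∉X) = sym (count-unique (exits? x) (sym inside≡x , paired) unique)
      where
      x-edge = partner-pairs x∈X
      j-data = complete (embed H⊆G (proj₁ x-edge)) (Ends-embed H⊆G (proj₂ (proj₂ x-edge))) x∈X px∉X
      j = proj₁ j-data
      inside≡x = proj₁ (proj₂ j-data)
      outside≡px = proj₂ (proj₂ j-data)
      paired : CutPattern M j
      paired = subst₂ (Pairs M) (sym inside≡x) (sym outside≡px) x-edge
      unique : ∀ i → x ≡ inside i × CutPattern M i → i ≡ j
      unique i (x≡i , i-paired) = injective (trans (sym x≡i) (sym inside≡x)) (begin
        outside i           ≡⟨ sym (Pairs⇒partner (inside∈X i) i-paired) ⟩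
        partner (inside i)  ≡⟨ cong partner (sym x≡i) ⟩
        partner x           ≡⟨ sym outside≡px ⟩
        outside j           ∎)
        where open ≡-Reasoning

  -- The vertices of X matched inside X come in pairs; the others are the X-ends of the cut
  -- edges of M.
  cut-parity : count (_∈? X) % 2 ≡ count cutPaired? % 2
  cut-parity = begin
    count (_∈? X) % 2                     ≡⟨ cong (_% 2) (count-split (_∈? X) (λ x → partner x ∈? X)) ⟩
    (count internal? + count leaving?) % 2 ≡⟨ cong (λ k → (k + count leaving?) % 2) internal-even ⟩
    (c * 2 + count leaving?) % 2          ≡⟨ cong (_% 2) (ℕₚ.+-comm (c * 2) _) ⟩
    (count leaving? + c * 2) % 2          ≡⟨ [m+kn]%n≡m%n (count leaving?) c 2 ⟩
    count leaving? % 2                    ≡⟨ cong (_% 2) leaving≡paired ⟩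
    count cutPaired? % 2                  ∎
    where
    open ≡-Reasoning
    internal-evenness = count-even internal? partner
      (λ (x∈X , px∈X) → px∈X , subst (_∈ X) (sym (partner-involutive x∈X px∈X)) x∈X)
      (λ (x∈X , px∈X) → partner-involutive x∈X px∈X)
      (λ (x∈X , _) → partner-irrefl x∈X)
    c = proj₁ internal-evenness
    internal-even = proj₂ internal-evenness
    leaving≡paired : count leaving? ≡ count cutPaired?
    leaving≡paired = begin
      count leaving?
        ≡⟨ sum-cong-≗ leaving-count ⟩
      sum (λ x → sum (λ j → indicator (exits? x j)))
        ≡⟨ ∑-comm (λ x j → indicator (exits? x j)) ⟩
      sum (λ j → sum (λ x → indicator (exits? x j)))
        ≡⟨ sum-cong-≗ (λ j → count-at (inside j) (cutPaired? j)) ⟩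
      count cutPaired? ∎

data OneOrAll (P : Fin 3 → Set) : Set where
  exactly : ∀ i → P i → (∀ j → P j → j ≡ i) → OneOrAll P
  every : (∀ j → P j) → OneOrAll P

odd⇒OneOrAll : {P : Fin 3 → Set} (P? : Decidable P) → count P? % 2 ≡ 1 → OneOrAll P
odd⇒OneOrAll {P} P? = go (P? 0F) (P? 1F) (P? 2F)
  where
  go : (a : Dec (P 0F)) (b : Dec (P 1F)) (c : Dec (P 2F)) →
    (indicator a + (indicator b + (indicator c + 0))) % 2 ≡ 1 → OneOrAll P
  go (yes a) (yes b) (yes c) _ = every λ { 0F → a ; 1F → b ; 2F → c }
  go (yes a) (no ¬b) (no ¬c) _ = exactly 0F a λ { 0F _ → refl ; 1F b → ⊥-elim (¬b b) ; 2F c → ⊥-elim (¬c c) }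
  go (no ¬a) (yes b) (no ¬c) _ = exactly 1F b λ { 0F a → ⊥-elim (¬a a) ; 1F _ → refl ; 2F c → ⊥-elim (¬c c) }
  go (no ¬a) (no ¬b) (yes c) _ = exactly 2F c λ { 0F a → ⊥-elim (¬a a) ; 1F b → ⊥-elim (¬b b) ; 2F _ → refl }
  go (yes _) (yes _) (no _) ()
  go (yes _) (no _) (yes _) ()
  go (no _) (yes _) (yes _) ()
  go (no _) (no _) (no _) ()

anyVec? : ∀ {n k} {P : Vec (Fin n) k → Set} → Decidable P → Dec (∃ P)
anyVec? {k = zero} P? = map′ ([] ,_) (λ { ([] , p) → p }) (P? [])
anyVec? {k = suc k} P? =
  map′ (λ (x , w , p) → x ∷ w , p) (λ { (x ∷ w , p) → x , w , p })
       (Finₚ.any? λ x → anyVec? (λ w → P? (x ∷ w)))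

-- A perfect matching is determined by its partner function, and these can be enumerated as
-- vectors; this makes the existence of a perfect matching with a decidable property decidable.
module PerfectMatchingSearch {n : ℕ} (G : Graph n) where

  Linked : Fin n → Fin n → Set
  Linked x y = (x < y × G x y ≡ true) ⊎ (y < x × G y x ≡ true)

  linked? : ∀ x y → Dec (Linked x y)
  linked? x y =
    ((x Finₚ.<? y) ×-dec (G x y Boolₚ.≟ true)) ⊎-dec ((y Finₚ.<? x) ×-dec (G y x Boolₚ.≟ true))

  IsPartnerFunction : (Fin n → Fin n) → Set
  IsPartnerFunction f = ∀ x → f (f x) ≡ x × f x ≢ x × Linked x (f x)

  isPartnerFunction? : Decidable IsPartnerFunction
  isPartnerFunction? f = Finₚ.all? λ x → (f (f x) ≟ x) ×-dec ¬? (f x ≟ x) ×-dec linked? x (f x)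

  matchingOf : (Fin n → Fin n) → EdgeSet G
  matchingOf f g = f (u g) ≡ v g

  module _ {f : Fin n → Fin n} (f-partner : IsPartnerFunction f) where

    matchingOf-perfect : IsPerfectMatching G (matchingOf f)
    matchingOf-perfect =
      matching-by-partners (λ z q → f z ≡ q) (λ fz≡q fz≡q′ → trans (sym fz≡q) fz≡q′) partner , covers
      where
      partner : ∀ {g p q} → matchingOf f g → Ends g p q → f p ≡ q
      partner fu≡v (fwd refl refl) = fu≡v
      partner fu≡v (bwd refl refl) = trans (cong f (sym fu≡v)) (proj₁ (f-partner _))
      covers : ∀ x → Covers (matchingOf f) x
      covers x with proj₂ (proj₂ (f-partner x))
      ... | inj₁ (x<fx , present) = edge x (f x) x<fx present , refl , inj₁ refl
      ... | inj₂ (fx<x , present) = edge (f x) x fx<x present , proj₁ (f-partner x) , inj₂ refl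

    matchingOf-pairs : ∀ x → Pairs (matchingOf f) x (f x)
    matchingOf-pairs x with proj₂ (proj₂ (f-partner x))
    ... | inj₁ (x<fx , present) = edge x (f x) x<fx present , refl , fwd refl refl
    ... | inj₂ (fx<x , present) = edge (f x) x fx<x present , proj₁ (f-partner x) , bwd refl refl

  partnerFunction : ∀ {N f} → IsPerfectMatching G N → (∀ x → Pairs N x (f x)) → IsPartnerFunction f
  partnerFunction {f = f} (N-matching , _) pairs x =
    Pairs-functional N-matching (pairs (f x)) (Pairs-sym (pairs x)) ,
    (λ fx≡x → let (g , _ , g-ends) = pairs x in Ends-irrefl (subst (Ends g x) fx≡x g-ends)) ,
    linked (proj₂ (proj₂ (pairs x)))
    where
    linked : ∀ {g : Edge G} {y} → Ends g x y → Linked x y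
    linked {g} (fwd refl refl) = inj₁ (u<v g , present g)
    linked {g} (bwd refl refl) = inj₂ (u<v g , present g)

  search : (P : (Fin n → Fin n) → Set) → Decidable P → (∀ {f g} → f ≗ g → P f → P g) →
    (∃₂ λ N f → IsPerfectMatching G N × (∀ x → Pairs N x (f x)) × P f)
    ⊎ (∀ N f → IsPerfectMatching G N → (∀ x → Pairs N x (f x)) → ¬ P f)
  search P P? P-resp with anyVec? (λ w → isPartnerFunction? (lookup w) ×-dec P? (lookup w))
  ... | yes (w , w-partner , Pw) =
    inj₁ (matchingOf (lookup w) , lookup w ,
          matchingOf-perfect w-partner , matchingOf-pairs w-partner , Pw)
  ... | no ∄w = inj₂ λ N f N-perfect pairs Pf →
    let w-pairs : ∀ x → Pairs N x (lookup (tabulate f) x)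
        w-pairs x = subst (Pairs N x) (sym (lookup∘tabulate f x)) (pairs x)
    in ∄w (tabulate f , partnerFunction N-perfect w-pairs , P-resp (sym ∘ lookup∘tabulate f) Pf)

PerfectThrough : ∀ {n} (G : Graph n) → Edge G → Set₁
PerfectThrough G e = Σ (EdgeSet G) λ M → IsPerfectMatching G M × M e

module _ {n : ℕ} {G : Graph n} (e₀ : Edge G) where

  deleteEdge-⊆ : deleteEdge G e₀ ⊆ᴳ G
  deleteEdge-⊆ x y = Boolₚ.∧-conicalˡ _ _

  keep : (e : Edge G) → ¬ SameEnds e e₀ → Edge (deleteEdge G e₀)
  keep e e≢e₀ = edge (u e) (v e) (u<v e) kept
    where
    kept : deleteEdge G e₀ (u e) (v e) ≡ true
    kept with u e ≟ u e₀ | v e ≟ v e₀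
    ... | yes a | yes b = ⊥-elim (e≢e₀ (a , b))
    ... | yes _ | no _ = trans (Boolₚ.∧-identityʳ _) (present e)
    ... | no _ | _ = trans (Boolₚ.∧-identityʳ _) (present e)

  Ends-keep : {e : Edge G} {e≢e₀ : ¬ SameEnds e e₀} {p q : Fin n} → Ends e p q → Ends (keep e e≢e₀) p q
  Ends-keep (fwd a b) = fwd a b
  Ends-keep (bwd a b) = bwd a b

  deleted-≢ : (f : Edge (deleteEdge G e₀)) → ¬ SameEnds f e₀
  deleted-≢ f (a , b) with u f ≟ u e₀ | v f ≟ v e₀ | present f
  ... | yes _ | yes _ | kept with trans (sym (Boolₚ.∧-zeroʳ (G (u f) (v f)))) kept
  ...   | ()
  deleted-≢ f (a , b) | no u≢ | _ | _ = u≢ a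
  deleted-≢ f (a , b) | yes _ | no v≢ | _ = v≢ b

module _ {n : ℕ} (X : Subset n) {G : Graph n} where

  MeetsX : Edge G → Set
  MeetsX f = u f ∈ X ⊎ v f ∈ X

  Incident⇒MeetsX : (f : Edge G) {x : Fin n} → Incident x f → x ∈ X → MeetsX f
  Incident⇒MeetsX f (inj₁ refl) x∈X = inj₁ x∈X
  Incident⇒MeetsX f (inj₂ refl) x∈X = inj₂ x∈X

  MeetsX-other : ∀ {f : Edge G} {z q} → MeetsX f → Ends f z q → z ∉ X → q ∈ X
  MeetsX-other (inj₁ u∈X) (fwd refl refl) z∉X = ⊥-elim (z∉X u∈X)
  MeetsX-other (inj₁ u∈X) (bwd refl refl) z∉X = u∈X
  MeetsX-other (inj₂ v∈X) (fwd refl refl) z∉X = v∈X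
  MeetsX-other (inj₂ v∈X) (bwd refl refl) z∉X = ⊥-elim (z∉X v∈X)

  InsideCompl-end : ∀ {f : Edge G} {z q} → InsideCompl X f → Ends f z q → z ∉ X
  InsideCompl-end (u∉X , _) (fwd refl refl) = u∉X
  InsideCompl-end (_ , v∉X) (bwd refl refl) = v∉X

  Ends⇒InsideCompl : ∀ {f : Edge G} {z q} → Ends f z q → z ∉ X → q ∉ X → InsideCompl X f
  Ends⇒InsideCompl (fwd refl refl) z∉X q∉X = z∉X , q∉X
  Ends⇒InsideCompl (bwd refl refl) z∉X q∉X = q∉X , z∉X

Pairs-Ends : ∀ {n} {H G : Graph n} {M : EdgeSet H} {f : Edge G} {z q} →
  Pairs M (u f) (v f) → Ends f z q → Pairs M z q
Pairs-Ends M∋f (fwd refl refl) = M∋f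
Pairs-Ends M∋f (bwd refl refl) = Pairs-sym M∋f

module Glue {n : ℕ} {G : Graph n} {X : Subset n} (e₀ : Edge G) (e₀-inside : InsideX X e₀)
  {M : EdgeSet (deleteEdge G e₀)} (M-matching : IsMatching (deleteEdge G e₀) M)
  (M-covers : ∀ x → x ∈ X → Covers M x)
  {N : EdgeSet G} (N-perfect : IsPerfectMatching G N)
  (M⇒N : ∀ {x y} → x ∈ X → y ∉ X → Pairs M x y → Pairs N x y)
  (N⇒M : ∀ {x y} → x ∈ X → y ∉ X → Pairs N x y → Pairs M x y) where

  glued : EdgeSet (deleteEdge G e₀)
  glued f = (MeetsX X f × Pairs M (u f) (v f)) ⊎ (InsideCompl X f × Pairs N (u f) (v f))

  private
    GluedPartner : Fin n → Fin n → Set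
    GluedPartner z q = (z ∈ X × Pairs M z q) ⊎ (z ∉ X × Pairs N z q)

    gluedPartner-functional : ∀ {z q q′} → GluedPartner z q → GluedPartner z q′ → q ≡ q′
    gluedPartner-functional (inj₁ (_ , zq)) (inj₁ (_ , zq′)) = Pairs-functional M-matching zq zq′
    gluedPartner-functional (inj₂ (_ , zq)) (inj₂ (_ , zq′)) = Pairs-functional (proj₁ N-perfect) zq zq′
    gluedPartner-functional (inj₁ (z∈X , _)) (inj₂ (z∉X , _)) = ⊥-elim (z∉X z∈X)
    gluedPartner-functional (inj₂ (z∉X , _)) (inj₁ (z∈X , _)) = ⊥-elim (z∉X z∈X)

    gluedPartner : ∀ {f z q} → glued f → Ends f z q → GluedPartner z q
    gluedPartner {z = z} (inj₁ (meets , M∋f)) f-ends with z ∈? X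
    ... | yes z∈X = inj₁ (z∈X , Pairs-Ends M∋f f-ends)
    ... | no z∉X = inj₂ (z∉X , Pairs-sym (M⇒N (MeetsX-other X meets f-ends z∉X) z∉X
                                            (Pairs-sym (Pairs-Ends M∋f f-ends))))
    gluedPartner (inj₂ (inside , N∋f)) f-ends =
      inj₂ (InsideCompl-end X inside f-ends , Pairs-Ends N∋f f-ends)

    glued-covers : ∀ z → Covers glued z
    glued-covers z with z ∈? X
    ... | yes z∈X = let (g , Mg , z∼g) = M-covers z z∈X in
      g , inj₁ (Incident⇒MeetsX X g z∼g z∈X , g , Mg , Ends-self) , z∼g
    ... | no z∉X =
      let (g , Ng , z∼g) = proj₂ N-perfect z
          (q , g-ends) = Incident⇒Ends g z∼g
      in cover-via g Ng g-ends (q ∈? X)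
      where
      cover-via : ∀ (g : Edge G) {q} → N g → Ends g z q → Dec (q ∈ X) → Covers glued z
      cover-via g Ng g-ends (yes q∈X) =
        let (g′ , Mg′ , g′-ends) = N⇒M q∈X z∉X (g , Ng , Ends-sym g-ends) in
        g′ , inj₁ (Incident⇒MeetsX X g′ (Ends⇒Incident g′-ends) q∈X , g′ , Mg′ , Ends-self) ,
        Ends⇒Incident (Ends-sym g′-ends)
      cover-via g Ng g-ends (no q∉X) =
        let inside = Ends⇒InsideCompl X g-ends z∉X q∉X in
        keep e₀ g (λ (a , _) → proj₁ inside (subst (_∈ X) (sym a) (proj₁ e₀-inside))) ,
        inj₂ (inside , g , Ng , Ends-self) , Ends⇒Incident g-ends

  glued-perfect : IsPerfectMatching (deleteEdge G e₀) glued
  glued-perfect = matching-by-partners GluedPartner gluedPartner-functional gluedPartner , glued-covers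

module _ {n : ℕ} {L : Graph n} where

  Adjacent-sym : ∀ {x y} → Adjacent L x y → Adjacent L y x
  Adjacent-sym (e , inj₁ ends) = e , inj₂ ends
  Adjacent-sym (e , inj₂ ends) = e , inj₁ ends

  Reach-trans : ∀ {x y z} → Reach L x y → Reach L y z → Reach L x z
  Reach-trans here s = s
  Reach-trans (step a r) s = step a (Reach-trans r s)

  Reach-snoc : ∀ {x y z} → Reach L x y → Adjacent L y z → Reach L x z
  Reach-snoc r a = Reach-trans r (step a here)

  Reach-sym : ∀ {x y} → Reach L x y → Reach L y x
  Reach-sym here = here
  Reach-sym (step a r) = Reach-snoc (Reach-sym r) (Adjacent-sym a)

halve : ∀ t → ∃ λ k → t ≡ k + k ⊎ t ≡ k + suc k
halve zero = 0 , inj₁ refl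
halve (suc t) with halve t
... | k , inj₁ t≡k+k = k , inj₂ (trans (cong suc t≡k+k) (sym (ℕₚ.+-suc k k)))
... | k , inj₂ t≡k+1+k = suc k , inj₁ (cong suc t≡k+1+k)

-- Walk from b alternately along q and p.  As σ = p ∘ q is a permutation, σᵈ⁺¹ b ≡ b for some d,
-- and then q (σᵈ b) ≡ p b ≡ a; before that a p-step can only be blocked at a, never at b.
module Alternating {n : ℕ} (L : Graph n) (p q : Fin n → Fin n)
  (p-involutive : ∀ x → p (p x) ≡ x) (q-involutive : ∀ x → q (q x) ≡ x)
  (p-irrefl : ∀ x → p x ≢ x) (q-irrefl : ∀ x → q x ≢ x)
  {a b : Fin n} (pb≡a : p b ≡ a)
  (q-adjacent : ∀ x → Adjacent L x (q x))
  (p-adjacent : ∀ x → x ≢ a → x ≢ b → Adjacent L x (p x)) where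

  σ : Fin n → Fin n
  σ x = p (q x)

  σ^ : ℕ → Fin n → Fin n
  σ^ zero x = x
  σ^ (suc k) x = σ (σ^ k x)

  σ^-+ : ∀ k l x → σ^ (k + l) x ≡ σ^ k (σ^ l x)
  σ^-+ zero l x = refl
  σ^-+ (suc k) l x = cong σ (σ^-+ k l x)

  σ-injective : ∀ {x y} → σ x ≡ σ y → x ≡ y
  σ-injective {x} {y} σx≡σy = begin
    x             ≡⟨ sym (q-involutive x) ⟩
    q (q x)       ≡⟨ cong q (sym (p-involutive (q x))) ⟩
    q (p (σ x))   ≡⟨ cong (q ∘ p) σx≡σy ⟩
    q (p (σ y))   ≡⟨ cong q (p-involutive (q y)) ⟩
    q (q y)       ≡⟨ q-involutive y ⟩
    y             ∎
    where open ≡-Reasoning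

  σ^-injective : ∀ k {x y} → σ^ k x ≡ σ^ k y → x ≡ y
  σ^-injective zero eq = eq
  σ^-injective (suc k) eq = σ^-injective k (σ-injective eq)

  -- q (σᵗ b) ≡ b would give q (σᵏ b) ≡ σˡ b whenever k + l ≡ t; taking k and l as equal as
  -- possible yields a fixed point of q or of p.
  q∘σ^-≢b : ∀ t → q (σ^ t b) ≢ b
  q∘σ^-≢b t q[σᵗb]≡b = balanced (halve t)
    where
    shift : ∀ k l → k + l ≡ t → q (σ^ k b) ≡ σ^ l b
    shift zero l refl = trans (cong q (sym q[σᵗb]≡b)) (q-involutive _)
    shift (suc k) l k+l≡t = begin
      q (p (q (σ^ k b)))         ≡⟨ cong (q ∘ p) (shift k (suc l) (trans (ℕₚ.+-suc k l) k+l≡t)) ⟩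
      q (p (p (q (σ^ l b))))     ≡⟨ cong q (p-involutive _) ⟩
      q (q (σ^ l b))             ≡⟨ q-involutive _ ⟩
      σ^ l b                     ∎
      where open ≡-Reasoning
    balanced : (∃ λ k → t ≡ k + k ⊎ t ≡ k + suc k) → ⊥
    balanced (k , inj₁ t≡k+k) = q-irrefl _ (shift k k (sym t≡k+k))
    balanced (k , inj₂ t≡k+1+k) = p-irrefl _ (sym (shift k (suc k) (sym t≡k+1+k)))

  σ-periodic : ∃ λ d → σ^ (suc d) b ≡ b
  σ-periodic =
    let (i , j , i<j , σⁱb≡σʲb) = Finₚ.pigeonhole (ℕₚ.n<1+n n) (λ (i : Fin (suc n)) → σ^ (Fin.toℕ i) b)
        (d , i+d+1≡j) = ℕₚ.m≤n⇒∃[o]m+o≡n i<j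
    in d , sym (σ^-injective (Fin.toℕ i) (begin
      σ^ (Fin.toℕ i) b                 ≡⟨ σⁱb≡σʲb ⟩
      σ^ (Fin.toℕ j) b                 ≡⟨ cong (λ k → σ^ k b) (sym (trans (ℕₚ.+-suc _ d) i+d+1≡j)) ⟩
      σ^ (Fin.toℕ i + suc d) b         ≡⟨ σ^-+ (Fin.toℕ i) (suc d) b ⟩
      σ^ (Fin.toℕ i) (σ^ (suc d) b)    ∎))
    where open ≡-Reasoning

  walk : ∀ t → Reach L b (σ^ t b) ⊎ Reach L b a
  walk zero = inj₁ here
  walk (suc t) with walk t
  ... | inj₂ b⟶a = inj₂ b⟶a
  ... | inj₁ b⟶σᵗb with q (σ^ t b) ≟ a
  ...   | yes q[σᵗb]≡a = inj₂ (subst (Reach L b) q[σᵗb]≡a (Reach-snoc b⟶σᵗb (q-adjacent _)))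
  ...   | no q[σᵗb]≢a =
    inj₁ (Reach-snoc (Reach-snoc b⟶σᵗb (q-adjacent _)) (p-adjacent _ q[σᵗb]≢a (q∘σ^-≢b t)))

  b⟶a : Reach L b a
  b⟶a with σ-periodic
  ... | d , σᵈ⁺¹b≡b with walk d
  ...   | inj₂ b⟶a = b⟶a
  ...   | inj₁ b⟶σᵈb = subst (Reach L b) q[σᵈb]≡a (Reach-snoc b⟶σᵈb (q-adjacent _))
    where
    q[σᵈb]≡a : q (σ^ d b) ≡ a
    q[σᵈb]≡a = trans (sym (p-involutive _)) (trans (cong p σᵈ⁺¹b≡b) pb≡a)

deleteEdge-connected : ∀ {n} {G : Graph n} (e₀ : Edge G) → Connected G → PerfectThrough G e₀ →
  Σ (EdgeSet (deleteEdge G e₀)) (IsPerfectMatching (deleteEdge G e₀)) → Connected (deleteEdge G e₀)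
deleteEdge-connected {G = G} e₀ connected (P , P-perfect , Pe₀) (Q , Q-perfect) x y = lift (connected x y)
  where
  module P = PerfectPartner P-perfect
  module Q = PerfectPartner Q-perfect

  P-adjacent : ∀ x → x ≢ u e₀ → x ≢ v e₀ → Adjacent (deleteEdge G e₀) x (P.partner x)
  P-adjacent x x≢a x≢b with P.partner-pairs {x} ∈⊤
  ... | g , _ , g-ends = Ends⇒Adjacent (Ends-keep e₀ {e≢e₀ = g≢e₀} g-ends)
    where
    g≢e₀ : ¬ SameEnds g e₀
    g≢e₀ g≈e₀ = [ x≢a ∘ sym , x≢b ∘ sym ]′ (Ends⇒Incident (Ends-transport {f = e₀} g≈e₀ g-ends))

  open Alternating (deleteEdge G e₀) P.partner Q.partner
    (λ x → P.partner-involutive {x} ∈⊤ ∈⊤) (λ x → Q.partner-involutive {x} ∈⊤ ∈⊤)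
    (λ x → P.partner-irrefl {x} ∈⊤) (λ x → Q.partner-irrefl {x} ∈⊤)
    (P.Pairs⇒partner ∈⊤ (e₀ , Pe₀ , bwd refl refl))
    (λ x → Ends⇒Adjacent (proj₂ (proj₂ (Q.partner-pairs {x} ∈⊤)))) P-adjacent

  across-e₀ : ∀ {x z} → Ends e₀ x z → Reach (deleteEdge G e₀) x z
  across-e₀ (fwd refl refl) = Reach-sym b⟶a
  across-e₀ (bwd refl refl) = b⟶a

  lift : ∀ {x y} → Reach G x y → Reach (deleteEdge G e₀) x y
  lift here = here
  lift (step (e , e-ends) r) with sameEnds? e e₀
  ... | no e≢e₀ = step (keep e₀ e e≢e₀ , e-ends) (lift r)
  ... | yes e≈e₀ =
    Reach-trans (across-e₀ (Ends-transport {f = e₀} e≈e₀ (adjacency-ends e-ends))) (lift r)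
    where
    adjacency-ends : ∀ {x z} → ((u e ≡ x) × (v e ≡ z)) ⊎ ((u e ≡ z) × (v e ≡ x)) → Ends e x z
    adjacency-ends (inj₁ (a , b)) = fwd a b
    adjacency-ends (inj₂ (a , b)) = bwd a b

CutSize3⇒CutEnumeration : ∀ {n} {G : Graph n} {X : Subset n} → CutSize3 G X → CutEnumeration G X 3
CutSize3⇒CutEnumeration {n} {G} {X} (c₁ , c₂ , c₃ , k₁ , k₂ , k₃ , c₁≉c₂ , c₁≉c₃ , c₂≉c₃ , classify) =
  record
  { cutEdge = c
  ; inside = λ j → inner (c j) (crossing j)
  ; outside = λ j → outer (c j) (crossing j)
  ; inside∈X = λ j → inner∈X (c j) (crossing j)
  ; outside∉X = λ j → outer∉X (c j) (crossing j)
  ; cutEdge-ends = λ j → Ends-inner-outer (c j) (crossing j)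
  ; injective = λ {i} {j} in≡ out≡ → distinct i j (Ends⇒SameEnds (c i) (c j)
      (subst₂ (Ends (c i)) in≡ out≡ (Ends-inner-outer (c i) (crossing i)))
      (Ends-inner-outer (c j) (crossing j)))
  ; complete = complete
  }
  where
  c : Fin 3 → Edge G
  c 0F = c₁
  c 1F = c₂
  c 2F = c₃

  crossing : ∀ j → Crossing X (c j)
  crossing 0F = k₁
  crossing 1F = k₂
  crossing 2F = k₃

  distinct : ∀ i j → SameEnds (c i) (c j) → i ≡ j
  distinct 0F 0F _ = refl
  distinct 1F 1F _ = refl
  distinct 2F 2F _ = refl
  distinct 0F 1F s = ⊥-elim (c₁≉c₂ s)
  distinct 0F 2F s = ⊥-elim (c₁≉c₃ s)
  distinct 1F 2F s = ⊥-elim (c₂≉c₃ s)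
  distinct 1F 0F (a , b) = ⊥-elim (c₁≉c₂ (sym a , sym b))
  distinct 2F 0F (a , b) = ⊥-elim (c₁≉c₃ (sym a , sym b))
  distinct 2F 1F (a , b) = ⊥-elim (c₂≉c₃ (sym a , sym b))

  index : (e : Edge G) → Crossing X e → ∃ λ j → SameEnds e (c j)
  index e e-crossing with classify e e-crossing
  ... | inj₁ e≈c₁ = 0F , e≈c₁
  ... | inj₂ (inj₁ e≈c₂) = 1F , e≈c₂
  ... | inj₂ (inj₂ e≈c₃) = 2F , e≈c₃

  complete : ∀ {x y} (e : Edge G) → Ends e x y → x ∈ X → y ∉ X →
    ∃ λ j → inner (c j) (crossing j) ≡ x × outer (c j) (crossing j) ≡ y
  complete e e-ends x∈X y∉X =
    let (j , e≈cⱼ) = index e (Ends⇒Crossing e-ends x∈X y∉X)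
    in j , crossing-orientation (Ends-inner-outer (c j) (crossing j)) (inner∈X (c j) (crossing j))
             (outer∉X (c j) (crossing j)) (Ends-transport {f = c j} e≈cⱼ e-ends) x∈X y∉X

module ThreeCut {n : ℕ} {G : Graph n} {X : Subset n} (cut : CutEnumeration G X 3) (good : GoodCut G X)
  where

  open CutEnumerationProperties cut public

  separating-pattern : ∀ i → Σ (EdgeSet G) λ N →
    IsPerfectMatching G N × CutPattern N i × (∀ j → CutPattern N j → j ≡ i)
  separating-pattern i =
    let (N , N-perfect , N∋cᵢ , _ , unique) = proj₁ good (cutEdge i)
    in N , N-perfect , (cutEdge i , N∋cᵢ , cutEdge-ends i) ,
       only-cutEdge ⊆ᴳ-refl i
         (λ f Nf f-crossing → unique f (cutEdge i) Nf f-crossing N∋cᵢ (cutEdge-crossing i))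

  X-odd : count (_∈? X) % 2 ≡ 1
  X-odd =
    let (N , N-perfect , N∋c₀ , only-c₀) = separating-pattern 0F
        open CutParity cut ⊆ᴳ-refl (proj₁ N-perfect) (λ x _ → proj₂ N-perfect x)
    in trans cut-parity (cong (_% 2) (count-unique cutPaired? N∋c₀ only-c₀))

  cutPattern : {H : Graph n} → H ⊆ᴳ G → {M : EdgeSet H} → IsMatching H M → (∀ x → x ∈ X → Covers M x) →
    OneOrAll (CutPattern M)
  cutPattern H⊆G M-matching M-covers =
    odd⇒OneOrAll cutPaired? (trans (sym cut-parity) X-odd)
    where open CutParity cut H⊆G M-matching M-covers

  everyCutPaired : Σ (EdgeSet G) λ N → IsPerfectMatching G N × (∀ j → CutPattern N j)
  everyCutPaired with PerfectMatchingSearch.search G (λ f → ∀ j → f (inside j) ≡ outside j)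
                        (λ f → Finₚ.all? λ j → f (inside j) ≟ outside j)
                        (λ f≗g all j → trans (sym (f≗g _)) (all j))
  ... | inj₁ (N , f , N-perfect , pairs , all) =
    N , N-perfect , λ j → subst (Pairs N _) (all j) (pairs (inside j))
  ... | inj₂ none = ⊥-elim (proj₂ good tight)
    where
    tight : Tight G X
    tight N N-perfect with cutPattern ⊆ᴳ-refl (proj₁ N-perfect) (λ x _ → proj₂ N-perfect x)
    ... | every all = ⊥-elim (none N partner N-perfect (λ x → partner-pairs {x} ∈⊤)
                                     λ j → Pairs⇒partner ∈⊤ (all j))
      where open PerfectPartner N-perfect
    ... | exactly i (g , Ng , g-ends) only-i =
      (g , Ng , Ends⇒Crossing g-ends (inside∈X i) (outside∉X i)) ,
      λ e f Ne e-crossing Nf f-crossing → Ends⇒SameEnds e f (at-i e Ne e-crossing) (at-i f Nf f-crossing)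
      where
      at-i : ∀ e → N e → Crossing X e → Ends e (inside i) (outside i)
      at-i e Ne e-crossing =
        let (j , e-ends) = crossing⇒cutEdge ⊆ᴳ-refl e e-crossing
        in subst (λ k → Ends e (inside k) (outside k)) (only-i j (e , Ne , e-ends)) e-ends

  realise : {H : Graph n} {M : EdgeSet H} → OneOrAll (CutPattern M) →
    Σ (EdgeSet G) λ N → IsPerfectMatching G N × (∀ j → CutPattern M j ⇔ CutPattern N j)
  realise (exactly i Mᵢ M-only) =
    let (N , N-perfect , Nᵢ , N-only) = separating-pattern i
    in N , N-perfect , exactly-agree Mᵢ M-only Nᵢ N-only
  realise (every M-all) =
    let (N , N-perfect , N-all) = everyCutPaired
    in N , N-perfect , λ j → mk⇔ (λ _ → N-all j) (λ _ → M-all j)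

module _ {n : ℕ} (X : Subset n) {H : Graph n} where

  region : (e : Edge H) → (Crossing X e ⊎ InsideX X e) ⊎ InsideCompl X e
  region e with u e ∈? X | v e ∈? X
  ... | yes u∈X | yes v∈X = inj₁ (inj₂ (u∈X , v∈X))
  ... | yes u∈X | no v∉X = inj₁ (inj₁ (inj₁ (u∈X , v∉X)))
  ... | no u∉X | yes v∈X = inj₁ (inj₁ (inj₂ (u∉X , v∈X)))
  ... | no u∉X | no v∉X = inj₂ (u∉X , v∉X)

  meetsX : (e : Edge H) → Crossing X e ⊎ InsideX X e → MeetsX X e
  meetsX e (inj₁ (inj₁ (u∈X , _))) = inj₁ u∈X
  meetsX e (inj₁ (inj₂ (_ , v∈X))) = inj₂ v∈X
  meetsX e (inj₂ (u∈X , _)) = inj₁ u∈X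

  crossing-≉-inside : {G : Graph n} {e : Edge H} {f : Edge G} →
    Crossing X e → InsideX X f → ¬ SameEnds e f
  crossing-≉-inside (inj₁ (_ , v∉X)) (_ , v∈X) (_ , refl) = v∉X v∈X
  crossing-≉-inside (inj₂ (u∉X , _)) (u∈X , _) (refl , _) = u∉X u∈X

module Removal {n : ℕ} {G : Graph n} {X : Subset n} (cut : CutEnumeration G X 3) (good : GoodCut G X)
  (e₀ : Edge G) (e₀-inside : InsideX X e₀) (e₁ : Edge G) (e₁-crossing : Crossing X e₁)
  (e₁-free : ∀ (f : Edge G) → InsideCompl X f → ¬ DependsOn G f e₁)
  (hyp : ∀ (e : Edge G) → (Crossing X e ⊎ InsideX X e) → ¬ SameEnds e e₀
         → Σ (EdgeSet (deleteEdge G e₀)) λ M →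
             IsMatching (deleteEdge G e₀) M
             × (Σ (Edge (deleteEdge G e₀)) λ e′ → M e′ × SameEnds e′ e)
             × (∀ x → x ∈ X → Covers M x)
             × (Crossing X e → ¬ SameEnds e e₁
                  → ∀ f → M f → Crossing X f → SameEnds f e)) where

  open ThreeCut cut good

  G′ : Graph n
  G′ = deleteEdge G e₀

  glue : {M : EdgeSet G′} → IsMatching G′ M → (∀ x → x ∈ X → Covers M x) →
    {N : EdgeSet G} → IsPerfectMatching G N → (∀ j → CutPattern M j ⇔ CutPattern N j) →
    Σ (EdgeSet G′) λ K → IsPerfectMatching G′ K
      × (∀ f → MeetsX X f → Pairs M (u f) (v f) → K f)
      × (∀ f → InsideCompl X f → Pairs N (u f) (v f) → K f)
  glue M-matching M-covers N-perfect agree =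
    glued , glued-perfect , (λ _ meets M∋f → inj₁ (meets , M∋f)) , (λ _ inside N∋f → inj₂ (inside , N∋f))
    where
    open Glue e₀ e₀-inside M-matching M-covers N-perfect
      (transfer-crossing (deleteEdge-⊆ e₀) (λ j → Equivalence.to (agree j)))
      (transfer-crossing ⊆ᴳ-refl (λ j → Equivalence.from (agree j)))

  crossing-≉e₀ : (e : Edge G) → Crossing X e → ¬ SameEnds e e₀
  crossing-≉e₀ e e-crossing = crossing-≉-inside X {e = e} {f = e₀} e-crossing e₀-inside

  perfect-through-meetsX : (e : Edge G′) → Crossing X e ⊎ InsideX X e → PerfectThrough G′ e
  perfect-through-meetsX e side =
    let (M , M-matching , (e′ , Me′ , e′≈e) , M-covers , _) =
          hyp (embed (deleteEdge-⊆ e₀) e) side (deleted-≢ e₀ e)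
        (N , N-perfect , agree) = realise (cutPattern (deleteEdge-⊆ e₀) M-matching M-covers)
        (K , K-perfect , K⊇M , _) = glue M-matching M-covers N-perfect agree
    in K , K-perfect , K⊇M e (meetsX X e side) (e′ , Me′ , SameEnds⇒Ends {f = e} e′≈e)

  e₁-index : ∃ λ j₁ → Ends e₁ (inside j₁) (outside j₁)
  e₁-index = crossing⇒cutEdge ⊆ᴳ-refl e₁ e₁-crossing

  perfect-avoiding-e₁ : (f : Edge G) → InsideCompl X f →
    Σ (EdgeSet G) λ N → IsPerfectMatching G N × N f × ¬ N e₁
  perfect-avoiding-e₁ f f-outside with e₁-index
  ... | j₁ , e₁-ends with PerfectMatchingSearch.search G (λ π → π (u f) ≡ v f × π (inside j₁) ≢ outside j₁)
                            (λ π → (π (u f) ≟ v f) ×-dec ¬? (π (inside j₁) ≟ outside j₁))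
                            (λ π≗π′ (πu≡v , π-avoids) →
                               trans (sym (π≗π′ _)) πu≡v , π-avoids ∘ trans (π≗π′ _))
  ...   | inj₁ (N , π , N-perfect , pairs , πu≡v , π-avoids) =
    N , N-perfect , Pairs⇒∈ (subst (Pairs N _) πu≡v (pairs (u f))) Ends-self ,
    λ Ne₁ → π-avoids (Pairs-functional (proj₁ N-perfect) (pairs (inside j₁)) (e₁ , Ne₁ , e₁-ends))
  ...   | inj₂ none = ⊥-elim (e₁-free f f-outside depends)
    where
    depends : DependsOn G f e₁
    depends N N-perfect Nf = decide (partner (inside j₁) ≟ outside j₁)
      where
      open PerfectPartner N-perfect
      decide : Dec (partner (inside j₁) ≡ outside j₁) → N e₁
      decide (yes paired) = Pairs⇒∈ (subst (Pairs N _) paired (partner-pairs ∈⊤)) e₁-ends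
      decide (no avoids) = ⊥-elim (none N partner N-perfect (λ x → partner-pairs {x} ∈⊤)
                                    (Pairs⇒partner ∈⊤ (f , Nf , Ends-self) , avoids))

  perfect-through-insideCompl : (e : Edge G′) → InsideCompl X e → PerfectThrough G′ e
  perfect-through-insideCompl e e-outside
    with perfect-avoiding-e₁ (embed (deleteEdge-⊆ e₀) e) e-outside
  ... | N , N-perfect , N∋e , N∌e₁ with cutPattern ⊆ᴳ-refl (proj₁ N-perfect) (λ x _ → proj₂ N-perfect x)
  ...   | every N-all = let (j₁ , e₁-ends) = e₁-index in ⊥-elim (N∌e₁ (Pairs⇒∈ (N-all j₁) e₁-ends))
  ...   | exactly i Nᵢ N-only =
    let (M , M-matching , (c′ , Mc′ , c′≈cᵢ) , M-covers , sole) =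
          hyp (cutEdge i) (inj₁ (cutEdge-crossing i)) (crossing-≉e₀ (cutEdge i) (cutEdge-crossing i))
        Mᵢ = Pairs-Ends (c′ , Mc′ , SameEnds⇒Ends {f = cutEdge i} c′≈cᵢ) (cutEdge-ends i)
        M-only = only-cutEdge (deleteEdge-⊆ e₀) i (sole (cutEdge-crossing i) cᵢ≉e₁)
        (K , K-perfect , _ , K⊇N) =
          glue M-matching M-covers N-perfect (exactly-agree Mᵢ M-only Nᵢ N-only)
    in K , K-perfect , K⊇N e e-outside (_ , N∋e , Ends-self)
    where
    cᵢ≉e₁ : ¬ SameEnds (cutEdge i) e₁
    cᵢ≉e₁ cᵢ≈e₁ = N∌e₁ (Pairs⇒∈ Nᵢ (Ends-transport {f = e₁} cᵢ≈e₁ (cutEdge-ends i)))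

  perfect-through : (e : Edge G′) → PerfectThrough G′ e
  perfect-through e with region X e
  ... | inj₁ meets = perfect-through-meetsX e meets
  ... | inj₂ outside = perfect-through-insideCompl e outside

proposition2p8 : ∀ {n} (G : Graph n) → MatchingCovered G
  → (X : Subset n) → GoodCut G X → CutSize3 G X
  → (e₀ : Edge G) → InsideX X e₀
  → (e₁ : Edge G) → Crossing X e₁
  → (∀ (f : Edge G) → InsideCompl X f → ¬ DependsOn G f e₁)
  → (∀ (e : Edge G) → (Crossing X e ⊎ InsideX X e) → ¬ SameEnds e e₀
       → Σ (EdgeSet (deleteEdge G e₀)) λ M →
           IsMatching (deleteEdge G e₀) M
           × (Σ (Edge (deleteEdge G e₀)) λ e′ → M e′ × SameEnds e′ e)
           × (∀ x → x ∈ X → Covers M x)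
           × (Crossing X e → ¬ SameEnds e e₁
                → ∀ f → M f → Crossing X f → SameEnds f e))
  → Removable G e₀
proposition2p8 G (connected , perfect-through-G) X good size3 e₀ e₀-inside e₁ e₁-crossing e₁-free hyp =
  let (Q , Q-perfect , _) = perfect-through (keep e₀ e₁ (crossing-≉e₀ e₁ e₁-crossing))
  in deleteEdge-connected e₀ connected (perfect-through-G e₀) (Q , Q-perfect) , perfect-through
  where open Removal (CutSize3⇒CutEnumeration size3) good e₀ e₀-inside e₁ e₁-crossing e₁-free hyp
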